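{- (Backward closure of $\mathsf{SN}$.) If $t\in\mathsf{SN}$ and $s\to_{\mathsf{SN}} t$, then $s\in\mathsf{SN}$.
   Context: $\mathbf{KP}$-terms: $t,s,u ::= x \mid t\,s \mid \lambda x.t \mid \mathtt{efq}(t) \mid \langle t,s\rangle \mid \pi_i t \mid \mathtt{in}_i t \mid \mathtt{case}\ t\ [y.s_1]\ [y.s_2] \mid \mathtt{hop}(x.t,\ y.s_1,\ y.s_2)$ ($i\in\{1,2\}$), with $y$ bound in $s_1,s_2$ in $\mathtt{case}$ and $\mathtt{hop}$, $x$ bound in $t$ in $\mathtt{hop}$; $t\{x:=s\}$ is capture-avoiding substitution. Weak head $\mathbf{IPC}$ contexts: $W::=\Box\mid W\,t\mid\pi_i W\mid\mathtt{case}\ W\ [y.s_1]\ [y.s_2]$; weak head $\mathbf{KP}$ contexts: $K::=\Box\mid K\,s\mid\pi_i K\mid\mathtt{case}\ K\ [y.s_1]\ [y.s_2]\mid\mathtt{hop}(x.K,\ y.s_1,\ y.s_2)$; $K\langle t\rangle$ replaces the hole by $t$. Top-level reduction $\mapsto_{\mathbf{KP}}$: $(\lambda x.t)s\mapsto t\{x:=s\}$; $\pi_i\langle t_1,t_2\rangle\mapsto t_i$; $\mathtt{case}\,(\mathtt{in}_i t)\,[y.s_1][y.s_2]\mapsto s_i\{y:=t\}$; $\mathtt{hop}(x.\mathtt{in}_i t,y.s_1,y.s_2)\mapsto s_i\{y:=\lambda x.t\}$; $\mathtt{hop}(x.W\langle\mathtt{efq}(t)\rangle,y.s_1,y.s_2)\mapsto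 s_1\{y:=\lambda x.\mathtt{efq}(t)\}$; $\to_{\mathbf{KP}}$ is its closure under all term constructors. $\mathsf{SN}$ is the set of terms strongly normalizing for $\to_{\mathbf{KP}}$; a context is $\mathsf{SN}$ if all terms occurring in it are in $\mathsf{SN}$. $\to_{\mathsf{SN}}$ is defined by: $K\langle(\lambda x.t)s\rangle\to_{\mathsf{SN}} K\langle t\{x:=s\}\rangle$; $K\langle\pi_i\langle s_1,s_2\rangle\rangle\to_{\mathsf{SN}} K\langle s_i\rangle$; $K\langle\mathtt{case}\,(\mathtt{in}_i t)\,[y.s_1][y.s_2]\rangle\to_{\mathsf{SN}} K\langle s_i\{y:=t\}\rangle$; $K\langle\mathtt{hop}(x.\mathtt{in}_i t,y.s_1,y.s_2)\rangle\to_{\mathsf{SN}} K\langle s_i\{y:=\lambda x.t\}\rangle$; $K\langle\mathtt{hop}(x.W\langle\mathtt{efq}(t)\rangle,y.s_1,y.s_2)\rangle\to_{\mathsf{SN}} K\langle s_1\{y:=\lambda x.\mathtt{efq}(t)\}\rangle$; in each case for all $\mathsf{SN}$ contexts $W,K$ and $t,s,s_1,s_2\in\mathsf{SN}$. -}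

module Defs where

open import Data.Nat using (ℕ; zero; suc)
open import Induction.WellFounded using (Acc)

data I : Set where
  ₁ ₂ : I

sel : {A : Set} → I → A → A → A
sel ₁ a b = a
sel ₂ a b = b

-- KP-terms, de Bruijn indices (variable 0 = innermost binder).
--   lam t        : λx.t            (x bound in t)
--   case t s₁ s₂ : case t [y.s₁] [y.s₂]  (y bound in s₁, s₂)
--   hop t s₁ s₂  : hop(x.t, y.s₁, y.s₂)  (x bound in t; y bound in s₁, s₂)
data Tm : Set where
  var  : ℕ → Tm
  app  : Tm → Tm → Tm
  lam  : Tm → Tm
  efq  : Tm → Tm
  pair : Tm → Tm → Tm
  proj : I → Tm → Tm
  inj  : I → Tm → Tm
  case : Tm → Tm → Tm → Tm
  hop  : Tm → Tm → Tm → Tm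

ext : (ℕ → ℕ) → ℕ → ℕ
ext ρ zero    = zero
ext ρ (suc n) = suc (ρ n)

rename : (ℕ → ℕ) → Tm → Tm
rename ρ (var n)        = var (ρ n)
rename ρ (app t s)      = app (rename ρ t) (rename ρ s)
rename ρ (lam t)        = lam (rename (ext ρ) t)
rename ρ (efq t)        = efq (rename ρ t)
rename ρ (pair t s)     = pair (rename ρ t) (rename ρ s)
rename ρ (proj i t)     = proj i (rename ρ t)
rename ρ (inj i t)      = inj i (rename ρ t)
rename ρ (case t s₁ s₂) = case (rename ρ t) (rename (ext ρ) s₁) (rename (ext ρ) s₂)
rename ρ (hop t s₁ s₂)  = hop (rename (ext ρ) t) (rename (ext ρ) s₁) (rename (ext ρ) s₂)

exts : (ℕ → Tm) → ℕ → Tm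
exts σ zero    = var zero
exts σ (suc n) = rename suc (σ n)

subst : (ℕ → Tm) → Tm → Tm
subst σ (var n)        = σ n
subst σ (app t s)      = app (subst σ t) (subst σ s)
subst σ (lam t)        = lam (subst (exts σ) t)
subst σ (efq t)        = efq (subst σ t)
subst σ (pair t s)     = pair (subst σ t) (subst σ s)
subst σ (proj i t)     = proj i (subst σ t)
subst σ (inj i t)      = inj i (subst σ t)
subst σ (case t s₁ s₂) = case (subst σ t) (subst (exts σ) s₁) (subst (exts σ) s₂)
subst σ (hop t s₁ s₂)  = hop (subst (exts σ) t) (subst (exts σ) s₁) (subst (exts σ) s₂)

single : Tm → ℕ → Tm
single s zero    = s
single s (suc n) = var n

_[_] : Tm → Tm → Tm
t [ s ] = subst (single s) t

data WCtx : Set where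
  □     : WCtx
  appW  : WCtx → Tm → WCtx
  projW : I → WCtx → WCtx
  caseW : WCtx → Tm → Tm → WCtx

plugW : WCtx → Tm → Tm
plugW □             u = u
plugW (appW W t)    u = app (plugW W u) t
plugW (projW i W)   u = proj i (plugW W u)
plugW (caseW W s₁ s₂) u = case (plugW W u) s₁ s₂

-- Weak head KP contexts K (the hole of hopK lies under the binder x;
-- plugging is plain, non-capture-avoiding replacement)
data KCtx : Set where
  □     : KCtx
  appK  : KCtx → Tm → KCtx
  projK : I → KCtx → KCtx
  caseK : KCtx → Tm → Tm → KCtx
  hopK  : KCtx → Tm → Tm → KCtx

plugK : KCtx → Tm → Tm
plugK □               u = u
plugK (appK K s)      u = app (plugK K u) s
plugK (projK i K)     u = proj i (plugK K u)
plugK (caseK K s₁ s₂) u = case (plugK K u) s₁ s₂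
plugK (hopK K s₁ s₂)  u = hop (plugK K u) s₁ s₂

data _↦_ : Tm → Tm → Set where
  β     : ∀ t s → app (lam t) s ↦ (t [ s ])
  π     : ∀ i t₁ t₂ → proj i (pair t₁ t₂) ↦ sel i t₁ t₂
  ι     : ∀ i t s₁ s₂ → case (inj i t) s₁ s₂ ↦ (sel i s₁ s₂ [ t ])
  hopIn : ∀ i t s₁ s₂ → hop (inj i t) s₁ s₂ ↦ (sel i s₁ s₂ [ lam t ])
  hopEfq : ∀ W t s₁ s₂ → hop (plugW W (efq t)) s₁ s₂ ↦ (s₁ [ lam (efq t) ])

data _⟶_ : Tm → Tm → Set where
  top   : ∀ {t u} → t ↦ u → t ⟶ u
  appL  : ∀ {t t' s} → t ⟶ t' → app t s ⟶ app t' s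
  appR  : ∀ {t s s'} → s ⟶ s' → app t s ⟶ app t s'
  lamC  : ∀ {t t'} → t ⟶ t' → lam t ⟶ lam t'
  efqC  : ∀ {t t'} → t ⟶ t' → efq t ⟶ efq t'
  pairL : ∀ {t t' s} → t ⟶ t' → pair t s ⟶ pair t' s
  pairR : ∀ {t s s'} → s ⟶ s' → pair t s ⟶ pair t s'
  projC : ∀ {i t t'} → t ⟶ t' → proj i t ⟶ proj i t'
  injC  : ∀ {i t t'} → t ⟶ t' → inj i t ⟶ inj i t'
  case₀ : ∀ {t t' s₁ s₂} → t ⟶ t' → case t s₁ s₂ ⟶ case t' s₁ s₂
  case₁ : ∀ {t s₁ s₁' s₂} → s₁ ⟶ s₁' → case t s₁ s₂ ⟶ case t s₁' s₂
  case₂ : ∀ {t s₁ s₂ s₂'} → s₂ ⟶ s₂' → case t s₁ s₂ ⟶ case t s₁ s₂'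
  hop₀  : ∀ {t t' s₁ s₂} → t ⟶ t' → hop t s₁ s₂ ⟶ hop t' s₁ s₂
  hop₁  : ∀ {t s₁ s₁' s₂} → s₁ ⟶ s₁' → hop t s₁ s₂ ⟶ hop t s₁' s₂
  hop₂  : ∀ {t s₁ s₂ s₂'} → s₂ ⟶ s₂' → hop t s₁ s₂ ⟶ hop t s₁ s₂'

_⟵_ : Tm → Tm → Set
u ⟵ t = t ⟶ u

SN : Tm → Set
SN = Acc _⟵_

data SNW : WCtx → Set where
  □     : SNW □
  appW  : ∀ {W t} → SNW W → SN t → SNW (appW W t)
  projW : ∀ {i W} → SNW W → SNW (projW i W)
  caseW : ∀ {W s₁ s₂} → SNW W → SN s₁ → SN s₂ → SNW (caseW W s₁ s₂)

data SNK : KCtx → Set where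
  □     : SNK □
  appK  : ∀ {K s} → SNK K → SN s → SNK (appK K s)
  projK : ∀ {i K} → SNK K → SNK (projK i K)
  caseK : ∀ {K s₁ s₂} → SNK K → SN s₁ → SN s₂ → SNK (caseK K s₁ s₂)
  hopK  : ∀ {K s₁ s₂} → SNK K → SN s₁ → SN s₂ → SNK (hopK K s₁ s₂)

data _⟶SN_ : Tm → Tm → Set where
  β     : ∀ {K t s} → SNK K → SN t → SN s →
          plugK K (app (lam t) s) ⟶SN plugK K (t [ s ])
  π     : ∀ {K i s₁ s₂} → SNK K → SN s₁ → SN s₂ →
          plugK K (proj i (pair s₁ s₂)) ⟶SN plugK K (sel i s₁ s₂)
  ι     : ∀ {K i t s₁ s₂} → SNK K → SN t → SN s₁ → SN s₂ →
          plugK K (case (inj i t) s₁ s₂) ⟶SN plugK K (sel i s₁ s₂ [ t ])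
  hopIn : ∀ {K i t s₁ s₂} → SNK K → SN t → SN s₁ → SN s₂ →
          plugK K (hop (inj i t) s₁ s₂) ⟶SN plugK K (sel i s₁ s₂ [ lam t ])
  hopEfq : ∀ {K W t s₁ s₂} → SNK K → SNW W → SN t → SN s₁ → SN s₂ →
          plugK K (hop (plugW W (efq t)) s₁ s₂) ⟶SN plugK K (s₁ [ lam (efq t) ])

module Submission where

-- A step s →SN t contracts a weak-head redex inside a weak head KP context K,
-- and every term involved (the terms of K, the subterms of the redex and, for
-- the efq-rule of hop, the terms of the IPC context W) is SN.  We collect
-- these "components" in a binary tree c and record the step as a relation
-- HeadStep c s t.  The key lemma headStep-step says that every one-step
-- reduct s₂ of s is either t itself, or again the source of a head step
-- s₂ ↝ t₂ whose component tree has made one step and with t ⟶* t₂.  A tree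
-- of SN components is accessible for componentwise reduction, so
-- well-founded induction on the tree, together with the forward closure of
-- SN under ⟶*, proves s ∈ SN.

open import Defs
open import Data.Nat using (ℕ; zero; suc)
open import Data.Product using (∃; _×_; _,_)
open import Data.Sum using (_⊎_; inj₁; inj₂)
open import Data.Empty using (⊥; ⊥-elim)
open import Function using (_∘_; flip)
open import Induction.WellFounded using (Acc; acc)
open import Relation.Binary.Construct.Closure.ReflexiveTransitive
  using (Star; ε; _◅_; _◅◅_; gmap; return)
open import Relation.Binary.PropositionalEquality
  using (_≡_; _≢_; _≗_; refl; sym; trans; cong; cong₂; subst₂)

cong₃ : ∀ {A B C D : Set} (f : A → B → C → D) {a a' b b' c c'} →
        a ≡ a' → b ≡ b' → c ≡ c' → f a b c ≡ f a' b' c'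
cong₃ f refl refl refl = refl

-- Each is stated for an
-- arbitrary pointwise description of the composite, so that it can be
-- pushed under binders without function extensionality.

ext-fuse : ∀ {ρ ρ' ρ''} → ρ ∘ ρ' ≗ ρ'' → ext ρ ∘ ext ρ' ≗ ext ρ''
ext-fuse e zero    = refl
ext-fuse e (suc n) = cong suc (e n)

rename-rename : ∀ {ρ ρ' ρ''} → ρ ∘ ρ' ≗ ρ'' → ∀ t → rename ρ (rename ρ' t) ≡ rename ρ'' t
rename-rename e (var n)        = cong var (e n)
rename-rename e (app t s)      = cong₂ app (rename-rename e t) (rename-rename e s)
rename-rename e (lam t)        = cong lam (rename-rename (ext-fuse e) t)
rename-rename e (efq t)        = cong efq (rename-rename e t)
rename-rename e (pair t s)     = cong₂ pair (rename-rename e t) (rename-rename e s)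
rename-rename e (proj i t)     = cong (proj i) (rename-rename e t)
rename-rename e (inj i t)      = cong (inj i) (rename-rename e t)
rename-rename e (case t s₁ s₂) =
  cong₃ case (rename-rename e t) (rename-rename (ext-fuse e) s₁) (rename-rename (ext-fuse e) s₂)
rename-rename e (hop t s₁ s₂)  =
  cong₃ hop (rename-rename (ext-fuse e) t) (rename-rename (ext-fuse e) s₁) (rename-rename (ext-fuse e) s₂)

exts-ext : ∀ {σ ρ τ} → σ ∘ ρ ≗ τ → exts σ ∘ ext ρ ≗ exts τ
exts-ext e zero    = refl
exts-ext e (suc n) = cong (rename suc) (e n)

subst-rename : ∀ {σ ρ τ} → σ ∘ ρ ≗ τ → ∀ t → subst σ (rename ρ t) ≡ subst τ t
subst-rename e (var n)        = e n
subst-rename e (app t s)      = cong₂ app (subst-rename e t) (subst-rename e s)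
subst-rename e (lam t)        = cong lam (subst-rename (exts-ext e) t)
subst-rename e (efq t)        = cong efq (subst-rename e t)
subst-rename e (pair t s)     = cong₂ pair (subst-rename e t) (subst-rename e s)
subst-rename e (proj i t)     = cong (proj i) (subst-rename e t)
subst-rename e (inj i t)      = cong (inj i) (subst-rename e t)
subst-rename e (case t s₁ s₂) =
  cong₃ case (subst-rename e t) (subst-rename (exts-ext e) s₁) (subst-rename (exts-ext e) s₂)
subst-rename e (hop t s₁ s₂)  =
  cong₃ hop (subst-rename (exts-ext e) t) (subst-rename (exts-ext e) s₁) (subst-rename (exts-ext e) s₂)

ext-exts : ∀ {ρ σ τ} → rename ρ ∘ σ ≗ τ → rename (ext ρ) ∘ exts σ ≗ exts τ
ext-exts e zero = refl
ext-exts {ρ} {σ} e (suc n) =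
  trans (rename-rename (λ _ → refl) (σ n))
        (trans (sym (rename-rename (λ _ → refl) (σ n))) (cong (rename suc) (e n)))

rename-subst : ∀ {ρ σ τ} → rename ρ ∘ σ ≗ τ → ∀ t → rename ρ (subst σ t) ≡ subst τ t
rename-subst e (var n)        = e n
rename-subst e (app t s)      = cong₂ app (rename-subst e t) (rename-subst e s)
rename-subst e (lam t)        = cong lam (rename-subst (ext-exts e) t)
rename-subst e (efq t)        = cong efq (rename-subst e t)
rename-subst e (pair t s)     = cong₂ pair (rename-subst e t) (rename-subst e s)
rename-subst e (proj i t)     = cong (proj i) (rename-subst e t)
rename-subst e (inj i t)      = cong (inj i) (rename-subst e t)
rename-subst e (case t s₁ s₂) =
  cong₃ case (rename-subst e t) (rename-subst (ext-exts e) s₁) (rename-subst (ext-exts e) s₂)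
rename-subst e (hop t s₁ s₂)  =
  cong₃ hop (rename-subst (ext-exts e) t) (rename-subst (ext-exts e) s₁) (rename-subst (ext-exts e) s₂)

exts-exts : ∀ {σ τ υ} → subst σ ∘ τ ≗ υ → subst (exts σ) ∘ exts τ ≗ exts υ
exts-exts e zero = refl
exts-exts {σ} {τ} e (suc n) =
  trans (subst-rename (λ _ → refl) (τ n))
        (trans (sym (rename-subst (λ _ → refl) (τ n))) (cong (rename suc) (e n)))

subst-subst : ∀ {σ τ υ} → subst σ ∘ τ ≗ υ → ∀ t → subst σ (subst τ t) ≡ subst υ t
subst-subst e (var n)        = e n
subst-subst e (app t s)      = cong₂ app (subst-subst e t) (subst-subst e s)
subst-subst e (lam t)        = cong lam (subst-subst (exts-exts e) t)
subst-subst e (efq t)        = cong efq (subst-subst e t)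
subst-subst e (pair t s)     = cong₂ pair (subst-subst e t) (subst-subst e s)
subst-subst e (proj i t)     = cong (proj i) (subst-subst e t)
subst-subst e (inj i t)      = cong (inj i) (subst-subst e t)
subst-subst e (case t s₁ s₂) =
  cong₃ case (subst-subst e t) (subst-subst (exts-exts e) s₁) (subst-subst (exts-exts e) s₂)
subst-subst e (hop t s₁ s₂)  =
  cong₃ hop (subst-subst (exts-exts e) t) (subst-subst (exts-exts e) s₁) (subst-subst (exts-exts e) s₂)

exts-var : ∀ {σ} → σ ≗ var → exts σ ≗ var
exts-var e zero    = refl
exts-var e (suc n) = cong (rename suc) (e n)

subst-id : ∀ {σ} → σ ≗ var → ∀ t → subst σ t ≡ t
subst-id e (var n)        = e n
subst-id e (app t s)      = cong₂ app (subst-id e t) (subst-id e s)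
subst-id e (lam t)        = cong lam (subst-id (exts-var e) t)
subst-id e (efq t)        = cong efq (subst-id e t)
subst-id e (pair t s)     = cong₂ pair (subst-id e t) (subst-id e s)
subst-id e (proj i t)     = cong (proj i) (subst-id e t)
subst-id e (inj i t)      = cong (inj i) (subst-id e t)
subst-id e (case t s₁ s₂) = cong₃ case (subst-id e t) (subst-id (exts-var e) s₁) (subst-id (exts-var e) s₂)
subst-id e (hop t s₁ s₂)  =
  cong₃ hop (subst-id (exts-var e) t) (subst-id (exts-var e) s₁) (subst-id (exts-var e) s₂)

ext-as-exts : ∀ {ρ σ} → var ∘ ρ ≗ σ → var ∘ ext ρ ≗ exts σ
ext-as-exts e zero    = refl
ext-as-exts e (suc n) = cong (rename suc) (e n)

rename-as-subst : ∀ {ρ σ} → var ∘ ρ ≗ σ → ∀ t → rename ρ t ≡ subst σ t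
rename-as-subst e (var n)        = e n
rename-as-subst e (app t s)      = cong₂ app (rename-as-subst e t) (rename-as-subst e s)
rename-as-subst e (lam t)        = cong lam (rename-as-subst (ext-as-exts e) t)
rename-as-subst e (efq t)        = cong efq (rename-as-subst e t)
rename-as-subst e (pair t s)     = cong₂ pair (rename-as-subst e t) (rename-as-subst e s)
rename-as-subst e (proj i t)     = cong (proj i) (rename-as-subst e t)
rename-as-subst e (inj i t)      = cong (inj i) (rename-as-subst e t)
rename-as-subst e (case t s₁ s₂) =
  cong₃ case (rename-as-subst e t) (rename-as-subst (ext-as-exts e) s₁) (rename-as-subst (ext-as-exts e) s₂)
rename-as-subst e (hop t s₁ s₂)  =
  cong₃ hop (rename-as-subst (ext-as-exts e) t) (rename-as-subst (ext-as-exts e) s₁)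
            (rename-as-subst (ext-as-exts e) s₂)

subst-[] : ∀ σ t s → subst σ (t [ s ]) ≡ subst (exts σ) t [ subst σ s ]
subst-[] σ t s = trans (subst-subst (λ _ → refl) t) (sym (subst-subst single-after-exts t))
  where
  single-after-exts : subst (single (subst σ s)) ∘ exts σ ≗ subst σ ∘ single s
  single-after-exts zero    = refl
  single-after-exts (suc n) = trans (subst-rename (λ _ → refl) (σ n)) (subst-id (λ _ → refl) (σ n))

infix 4 _⟶*_
_⟶*_ : Tm → Tm → Set
_⟶*_ = Star _⟶_

substW : (ℕ → Tm) → WCtx → WCtx
substW σ □               = □
substW σ (appW W t)      = appW (substW σ W) (subst σ t)
substW σ (projW i W)     = projW i (substW σ W)
substW σ (caseW W s₁ s₂) = caseW (substW σ W) (subst (exts σ) s₁) (subst (exts σ) s₂)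

subst-plugW : ∀ σ W u → subst σ (plugW W u) ≡ plugW (substW σ W) (subst σ u)
subst-plugW σ □               u = refl
subst-plugW σ (appW W t)      u = cong (λ z → app z (subst σ t)) (subst-plugW σ W u)
subst-plugW σ (projW i W)     u = cong (proj i) (subst-plugW σ W u)
subst-plugW σ (caseW W s₁ s₂) u = cong (λ z → case z _ _) (subst-plugW σ W u)

subst-↦ : ∀ σ {t u} → t ↦ u → subst σ t ↦ subst σ u
subst-↦ σ (β t s) = subst₂ _↦_ refl (sym (subst-[] σ t s)) (β _ _)
subst-↦ σ (π ₁ t₁ t₂) = π ₁ _ _
subst-↦ σ (π ₂ t₁ t₂) = π ₂ _ _
subst-↦ σ (ι ₁ t s₁ s₂) = subst₂ _↦_ refl (sym (subst-[] σ s₁ t)) (ι ₁ _ _ _)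
subst-↦ σ (ι ₂ t s₁ s₂) = subst₂ _↦_ refl (sym (subst-[] σ s₂ t)) (ι ₂ _ _ _)
subst-↦ σ (hopIn ₁ t s₁ s₂) = subst₂ _↦_ refl (sym (subst-[] σ s₁ (lam t))) (hopIn ₁ _ _ _)
subst-↦ σ (hopIn ₂ t s₁ s₂) = subst₂ _↦_ refl (sym (subst-[] σ s₂ (lam t))) (hopIn ₂ _ _ _)
subst-↦ σ (hopEfq W t s₁ s₂) =
  subst₂ _↦_ (cong (λ z → hop z _ _) (sym (subst-plugW (exts σ) W (efq t))))
             (sym (subst-[] σ s₁ (lam (efq t))))
             (hopEfq _ _ _ _)

subst-⟶ : ∀ σ {t u} → t ⟶ u → subst σ t ⟶ subst σ u
subst-⟶ σ (top r)   = top (subst-↦ σ r)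
subst-⟶ σ (appL r)  = appL (subst-⟶ σ r)
subst-⟶ σ (appR r)  = appR (subst-⟶ σ r)
subst-⟶ σ (lamC r)  = lamC (subst-⟶ (exts σ) r)
subst-⟶ σ (efqC r)  = efqC (subst-⟶ σ r)
subst-⟶ σ (pairL r) = pairL (subst-⟶ σ r)
subst-⟶ σ (pairR r) = pairR (subst-⟶ σ r)
subst-⟶ σ (projC r) = projC (subst-⟶ σ r)
subst-⟶ σ (injC r)  = injC (subst-⟶ σ r)
subst-⟶ σ (case₀ r) = case₀ (subst-⟶ σ r)
subst-⟶ σ (case₁ r) = case₁ (subst-⟶ (exts σ) r)
subst-⟶ σ (case₂ r) = case₂ (subst-⟶ (exts σ) r)
subst-⟶ σ (hop₀ r)  = hop₀ (subst-⟶ (exts σ) r)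
subst-⟶ σ (hop₁ r)  = hop₁ (subst-⟶ (exts σ) r)
subst-⟶ σ (hop₂ r)  = hop₂ (subst-⟶ (exts σ) r)

rename-⟶ : ∀ ρ {t u} → t ⟶ u → rename ρ t ⟶ rename ρ u
rename-⟶ ρ {t} {u} r =
  subst₂ _⟶_ (sym (rename-as-subst (λ _ → refl) t)) (sym (rename-as-subst (λ _ → refl) u))
             (subst-⟶ (var ∘ ρ) r)

app* : ∀ {t t' s s'} → t ⟶* t' → s ⟶* s' → app t s ⟶* app t' s'
app* {t' = t'} {s = s} p q = gmap (λ z → app z s) appL p ◅◅ gmap (app t') appR q

pair* : ∀ {t t' s s'} → t ⟶* t' → s ⟶* s' → pair t s ⟶* pair t' s'
pair* {t' = t'} {s = s} p q = gmap (λ z → pair z s) pairL p ◅◅ gmap (pair t') pairR q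

case* : ∀ {t t' s₁ s₁' s₂ s₂'} → t ⟶* t' → s₁ ⟶* s₁' → s₂ ⟶* s₂' → case t s₁ s₂ ⟶* case t' s₁' s₂'
case* {t' = t'} {s₁ = s₁} {s₁' = s₁'} {s₂ = s₂} p q r =
  gmap (λ z → case z s₁ s₂) case₀ p ◅◅ gmap (λ z → case t' z s₂) case₁ q ◅◅ gmap (case t' s₁') case₂ r

hop* : ∀ {t t' s₁ s₁' s₂ s₂'} → t ⟶* t' → s₁ ⟶* s₁' → s₂ ⟶* s₂' → hop t s₁ s₂ ⟶* hop t' s₁' s₂'
hop* {t' = t'} {s₁ = s₁} {s₁' = s₁'} {s₂ = s₂} p q r =
  gmap (λ z → hop z s₁ s₂) hop₀ p ◅◅ gmap (λ z → hop t' z s₂) hop₁ q ◅◅ gmap (hop t' s₁') hop₂ r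

exts-⟶* : ∀ {σ σ'} → (∀ x → σ x ⟶* σ' x) → ∀ x → exts σ x ⟶* exts σ' x
exts-⟶* e zero    = ε
exts-⟶* e (suc n) = gmap (rename suc) (rename-⟶ suc) (e n)

subst-⟶* : ∀ {σ σ'} → (∀ x → σ x ⟶* σ' x) → ∀ t → subst σ t ⟶* subst σ' t
subst-⟶* e (var n)        = e n
subst-⟶* e (app t s)      = app* (subst-⟶* e t) (subst-⟶* e s)
subst-⟶* e (lam t)        = gmap lam lamC (subst-⟶* (exts-⟶* e) t)
subst-⟶* e (efq t)        = gmap efq efqC (subst-⟶* e t)
subst-⟶* e (pair t s)     = pair* (subst-⟶* e t) (subst-⟶* e s)
subst-⟶* e (proj i t)     = gmap (proj i) projC (subst-⟶* e t)
subst-⟶* e (inj i t)      = gmap (inj i) injC (subst-⟶* e t)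
subst-⟶* e (case t s₁ s₂) =
  case* (subst-⟶* e t) (subst-⟶* (exts-⟶* e) s₁) (subst-⟶* (exts-⟶* e) s₂)
subst-⟶* e (hop t s₁ s₂)  =
  hop* (subst-⟶* (exts-⟶* e) t) (subst-⟶* (exts-⟶* e) s₁) (subst-⟶* (exts-⟶* e) s₂)

inst-body* : ∀ {t t'} s → t ⟶* t' → t [ s ] ⟶* t' [ s ]
inst-body* s = gmap (subst (single s)) (subst-⟶ (single s))

inst-arg* : ∀ t {s s'} → s ⟶* s' → t [ s ] ⟶* t [ s' ]
inst-arg* t {s} {s'} p = subst-⟶* single-⟶* t
  where
  single-⟶* : ∀ x → single s x ⟶* single s' x
  single-⟶* zero    = p
  single-⟶* (suc n) = ε

sel*ˡ : ∀ i {a a' b} → a ⟶ a' → sel i a b ⟶* sel i a' b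
sel*ˡ ₁ r = return r
sel*ˡ ₂ r = ε

sel*ʳ : ∀ i {a b b'} → b ⟶ b' → sel i a b ⟶* sel i a b'
sel*ʳ ₁ r = ε
sel*ʳ ₂ r = return r

SN-⟶* : ∀ {t u} → SN t → t ⟶* u → SN u
SN-⟶* sn      ε       = sn
SN-⟶* (acc f) (r ◅ p) = SN-⟶* (f r) p

data Tree : Set where
  leaf : Tm → Tree
  node : Tree → Tree → Tree

data _⟶ᵀ_ : Tree → Tree → Set where
  leafS : ∀ {t t'} → t ⟶ t' → leaf t ⟶ᵀ leaf t'
  nodeL : ∀ {a a' b} → a ⟶ᵀ a' → node a b ⟶ᵀ node a' b
  nodeR : ∀ {a b b'} → b ⟶ᵀ b' → node a b ⟶ᵀ node a b'

SNᵀ : Tree → Set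
SNᵀ = Acc (flip _⟶ᵀ_)

SN-leaf : ∀ {t} → SN t → SNᵀ (leaf t)
SN-leaf (acc f) = acc λ { (leafS r) → SN-leaf (f r) }

SN-node : ∀ {a b} → SNᵀ a → SNᵀ b → SNᵀ (node a b)
SN-node (acc f) (acc g) =
  acc λ { (nodeL r) → SN-node (f r) (acc g) ; (nodeR r) → SN-node (acc f) (g r) }

-- (4) EfqSpine e t c: e = W⟨efq t⟩ for a weak head IPC context W, where c
-- collects t and the terms of W.  Unlike plugW, this is an inductive
-- description of the shape that reductions of e can be matched against.

data EfqSpine : Tm → Tm → Tree → Set where
  efqS  : ∀ {t} → EfqSpine (efq t) t (leaf t)
  appS  : ∀ {e t c u} → EfqSpine e t c → EfqSpine (app e u) t (node c (leaf u))
  projS : ∀ {e t c i} → EfqSpine e t c → EfqSpine (proj i e) t c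
  caseS : ∀ {e t c s₁ s₂} → EfqSpine e t c →
          EfqSpine (case e s₁ s₂) t (node c (node (leaf s₁) (leaf s₂)))

spineTree : WCtx → Tm → Tree
spineTree □               t = leaf t
spineTree (appW W u)      t = node (spineTree W t) (leaf u)
spineTree (projW i W)     t = spineTree W t
spineTree (caseW W s₁ s₂) t = node (spineTree W t) (node (leaf s₁) (leaf s₂))

plugW-spine : ∀ W {t} → EfqSpine (plugW W (efq t)) t (spineTree W t)
plugW-spine □               = efqS
plugW-spine (appW W u)      = appS (plugW-spine W)
plugW-spine (projW i W)     = projS (plugW-spine W)
plugW-spine (caseW W s₁ s₂) = caseS (plugW-spine W)

SN-spineTree : ∀ {W t} → SNW W → SN t → SNᵀ (spineTree W t)
SN-spineTree □               sn = SN-leaf sn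
SN-spineTree (appW w su)     sn = SN-node (SN-spineTree w sn) (SN-leaf su)
SN-spineTree (projW w)       sn = SN-spineTree w sn
SN-spineTree (caseW w s₁ s₂) sn = SN-node (SN-spineTree w sn) (SN-node (SN-leaf s₁) (SN-leaf s₂))

spine-unique : ∀ W {t' t c} → EfqSpine (plugW W (efq t')) t c → t' ≡ t
spine-unique □               efqS      = refl
spine-unique (appW W u)      (appS w)  = spine-unique W w
spine-unique (projW i W)     (projS w) = spine-unique W w
spine-unique (caseW W s₁ s₂) (caseS w) = spine-unique W w

plugW-efq≢inj : ∀ W {i t t'} → plugW W (efq t') ≢ inj i t
plugW-efq≢inj □               ()
plugW-efq≢inj (appW W u)      ()
plugW-efq≢inj (projW i W)     ()
plugW-efq≢inj (caseW W s₁ s₂) ()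

data SpineReduct (t : Tm) (c : Tree) (e' : Tm) : Set where
  spineReduct : ∀ {t' c'} → EfqSpine e' t' c' → c ⟶ᵀ c' → t ⟶* t' → SpineReduct t c e'

spine-step : ∀ {e t c e'} → EfqSpine e t c → e ⟶ e' → SpineReduct t c e'
spine-step efqS (top ())
spine-step efqS (efqC r) = spineReduct efqS (leafS r) (return r)
spine-step (appS ()) (top (β _ _))
spine-step (appS w) (appL r) with spine-step w r
... | spineReduct w' cs p = spineReduct (appS w') (nodeL cs) p
spine-step (appS w) (appR r) = spineReduct (appS w) (nodeR (leafS r)) ε
spine-step (projS ()) (top (π _ _ _))
spine-step (projS w) (projC r) with spine-step w r
... | spineReduct w' cs p = spineReduct (projS w') cs p
spine-step (caseS ()) (top (ι _ _ _ _))
spine-step (caseS w) (case₀ r) with spine-step w r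
... | spineReduct w' cs p = spineReduct (caseS w') (nodeL cs) p
spine-step (caseS w) (case₁ r) = spineReduct (caseS w) (nodeR (nodeL (leafS r))) ε
spine-step (caseS w) (case₂ r) = spineReduct (caseS w) (nodeR (nodeR (leafS r))) ε

hop-inj-↦ : ∀ {i t s₁ s₂ u} → hop (inj i t) s₁ s₂ ↦ u → u ≡ sel i s₁ s₂ [ lam t ]
hop-inj-↦ r = invert r refl
  where
  invert : ∀ {a i t s₁ s₂ u} → hop a s₁ s₂ ↦ u → a ≡ inj i t → u ≡ sel i s₁ s₂ [ lam t ]
  invert (hopIn _ _ _ _)  refl = refl
  invert (hopEfq W _ _ _) e    = ⊥-elim (plugW-efq≢inj W e)

data Redex : Tree → Tm → Tm → Set where
  β      : ∀ {t s} → Redex (node (leaf t) (leaf s)) (app (lam t) s) (t [ s ])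
  π      : ∀ {i s₁ s₂} → Redex (node (leaf s₁) (leaf s₂)) (proj i (pair s₁ s₂)) (sel i s₁ s₂)
  ι      : ∀ {i t s₁ s₂} →
           Redex (node (leaf t) (node (leaf s₁) (leaf s₂))) (case (inj i t) s₁ s₂) (sel i s₁ s₂ [ t ])
  hopIn  : ∀ {i t s₁ s₂} →
           Redex (node (leaf t) (node (leaf s₁) (leaf s₂))) (hop (inj i t) s₁ s₂) (sel i s₁ s₂ [ lam t ])
  hopEfq : ∀ {e t c s₁ s₂} → EfqSpine e t c →
           Redex (node c (node (leaf s₁) (leaf s₂))) (hop e s₁ s₂) (s₁ [ lam (efq t) ])

data HeadStep : Tree → Tm → Tm → Set where
  redex : ∀ {c r r'} → Redex c r r' → HeadStep c r r'
  appH  : ∀ {c r r' s} → HeadStep c r r' → HeadStep (node c (leaf s)) (app r s) (app r' s)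
  projH : ∀ {c r r' i} → HeadStep c r r' → HeadStep c (proj i r) (proj i r')
  caseH : ∀ {c r r' s₁ s₂} → HeadStep c r r' →
          HeadStep (node c (node (leaf s₁) (leaf s₂))) (case r s₁ s₂) (case r' s₁ s₂)
  hopH  : ∀ {c r r' s₁ s₂} → HeadStep c r r' →
          HeadStep (node c (node (leaf s₁) (leaf s₂))) (hop r s₁ s₂) (hop r' s₁ s₂)

spine-not-head : ∀ {e t c c' r'} → EfqSpine e t c → HeadStep c' e r' → ⊥
spine-not-head efqS      (redex ())
spine-not-head (appS ()) (redex β)
spine-not-head (appS w)  (appH h)  = spine-not-head w h
spine-not-head (projS ()) (redex π)
spine-not-head (projS w) (projH h) = spine-not-head w h
spine-not-head (caseS ()) (redex ι)
spine-not-head (caseS w) (caseH h) = spine-not-head w h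

data Residual (c : Tree) (r' r₂ : Tm) : Set where
  residual : ∀ {c' r₂'} → c ⟶ᵀ c' → HeadStep c' r₂ r₂' → r' ⟶* r₂' → Residual c r' r₂

Outcome : Tree → Tm → Tm → Set
Outcome c r' r₂ = r₂ ≡ r' ⊎ Residual c r' r₂

advance : ∀ {c c' r' r₂ r₂'} → c ⟶ᵀ c' → Redex c' r₂ r₂' → r' ⟶* r₂' → Outcome c r' r₂
advance cs h p = inj₂ (residual cs (redex h) p)

redex-step : ∀ {c r r' r₂} → Redex c r r' → r ⟶ r₂ → Outcome c r' r₂
redex-step β (top (β _ _)) = inj₁ refl
redex-step β (appL (top ()))
redex-step (β {s = s}) (appL (lamC r)) = advance (nodeL (leafS r)) β (inst-body* s (return r))
redex-step (β {t = t}) (appR r)        = advance (nodeR (leafS r)) β (inst-arg* t (return r))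
redex-step π (top (π _ _ _)) = inj₁ refl
redex-step π (projC (top ()))
redex-step (π {i = i}) (projC (pairL r)) = advance (nodeL (leafS r)) π (sel*ˡ i r)
redex-step (π {i = i}) (projC (pairR r)) = advance (nodeR (leafS r)) π (sel*ʳ i r)
redex-step ι (top (ι _ _ _ _)) = inj₁ refl
redex-step ι (case₀ (top ()))
redex-step (ι {i} {s₁ = s₁} {s₂}) (case₀ (injC r)) =
  advance (nodeL (leafS r)) ι (inst-arg* (sel i s₁ s₂) (return r))
redex-step (ι {i} {t}) (case₁ r) = advance (nodeR (nodeL (leafS r))) ι (inst-body* t (sel*ˡ i r))
redex-step (ι {i} {t}) (case₂ r) = advance (nodeR (nodeR (leafS r))) ι (inst-body* t (sel*ʳ i r))
redex-step hopIn (top r) = inj₁ (hop-inj-↦ r)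
redex-step hopIn (hop₀ (top ()))
redex-step (hopIn {i} {s₁ = s₁} {s₂}) (hop₀ (injC r)) =
  advance (nodeL (leafS r)) hopIn (inst-arg* (sel i s₁ s₂) (return (lamC r)))
redex-step (hopIn {i} {t}) (hop₁ r) =
  advance (nodeR (nodeL (leafS r))) hopIn (inst-body* (lam t) (sel*ˡ i r))
redex-step (hopIn {i} {t}) (hop₂ r) =
  advance (nodeR (nodeR (leafS r))) hopIn (inst-body* (lam t) (sel*ʳ i r))
redex-step (hopEfq ()) (top (hopIn _ _ _ _))
redex-step (hopEfq {s₁ = s₁} w) (top (hopEfq W _ _ _)) =
  inj₁ (cong (λ z → s₁ [ lam (efq z) ]) (spine-unique W w))
redex-step (hopEfq {s₁ = s₁} w) (hop₀ r) with spine-step w r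
... | spineReduct w' cs p =
  advance (nodeL cs) (hopEfq w') (inst-arg* s₁ (gmap (lam ∘ efq) (lamC ∘ efqC) p))
redex-step (hopEfq {t = t} w) (hop₁ r) =
  advance (nodeR (nodeL (leafS r))) (hopEfq w) (inst-body* (lam (efq t)) (return r))
redex-step (hopEfq w) (hop₂ r) = advance (nodeR (nodeR (leafS r))) (hopEfq w) ε

-- The frames of the context are never contracted themselves:
-- the source of a head step is never a λ, a pair, an injection or of the shape
-- W⟨efq t⟩, so the context's own rules cannot fire.
headStep-step : ∀ {c r r' r₂} → HeadStep c r r' → r ⟶ r₂ → Outcome c r' r₂
headStep-step (redex h) r = redex-step h r
headStep-step (appH (redex ())) (top (β _ _))
headStep-step (appH h) (appL r) with headStep-step h r
... | inj₁ refl = inj₁ refl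
... | inj₂ (residual cs h' p) = inj₂ (residual (nodeL cs) (appH h') (app* p ε))
headStep-step (appH h) (appR r) = inj₂ (residual (nodeR (leafS r)) (appH h) (return (appR r)))
headStep-step (projH (redex ())) (top (π _ _ _))
headStep-step (projH h) (projC r) with headStep-step h r
... | inj₁ refl = inj₁ refl
... | inj₂ (residual cs h' p) = inj₂ (residual cs (projH h') (gmap (proj _) projC p))
headStep-step (caseH (redex ())) (top (ι _ _ _ _))
headStep-step (caseH h) (case₀ r) with headStep-step h r
... | inj₁ refl = inj₁ refl
... | inj₂ (residual cs h' p) = inj₂ (residual (nodeL cs) (caseH h') (case* p ε ε))
headStep-step (caseH h) (case₁ r) = inj₂ (residual (nodeR (nodeL (leafS r))) (caseH h) (return (case₁ r)))
headStep-step (caseH h) (case₂ r) = inj₂ (residual (nodeR (nodeR (leafS r))) (caseH h) (return (case₂ r)))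
headStep-step (hopH h) (top (hopEfq W _ _ _)) = ⊥-elim (spine-not-head (plugW-spine W) h)
headStep-step (hopH (redex ())) (top (hopIn _ _ _ _))
headStep-step (hopH h) (hop₀ r) with headStep-step h r
... | inj₁ refl = inj₁ refl
... | inj₂ (residual cs h' p) = inj₂ (residual (nodeL cs) (hopH h') (hop* p ε ε))
headStep-step (hopH h) (hop₁ r) = inj₂ (residual (nodeR (nodeL (leafS r))) (hopH h) (return (hop₁ r)))
headStep-step (hopH h) (hop₂ r) = inj₂ (residual (nodeR (nodeR (leafS r))) (hopH h) (return (hop₂ r)))

-- Backward closure for head steps, by induction on the accessible tree of
-- components: every reduct of r is SN, being either r' or, via a residual,
-- a head step with smaller components into a reduct of r'.
headStep-SN : ∀ {c r r'} → SNᵀ c → HeadStep c r r' → SN r' → SN r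
headStep-SN (acc f) h sn' = acc λ r → reduct-SN (headStep-step h r)
  where
  reduct-SN : ∀ {r₂} → Outcome _ _ r₂ → SN r₂
  reduct-SN (inj₁ refl)               = sn'
  reduct-SN (inj₂ (residual cs h' p)) = headStep-SN (f cs) h' (SN-⟶* sn' p)

ctxTree : KCtx → Tree → Tree
ctxTree □               c = c
ctxTree (appK K s)      c = node (ctxTree K c) (leaf s)
ctxTree (projK i K)     c = ctxTree K c
ctxTree (caseK K s₁ s₂) c = node (ctxTree K c) (node (leaf s₁) (leaf s₂))
ctxTree (hopK K s₁ s₂)  c = node (ctxTree K c) (node (leaf s₁) (leaf s₂))

plugK-headStep : ∀ K {c r r'} → Redex c r r' → HeadStep (ctxTree K c) (plugK K r) (plugK K r')
plugK-headStep □               h = redex h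
plugK-headStep (appK K s)      h = appH (plugK-headStep K h)
plugK-headStep (projK i K)     h = projH (plugK-headStep K h)
plugK-headStep (caseK K s₁ s₂) h = caseH (plugK-headStep K h)
plugK-headStep (hopK K s₁ s₂)  h = hopH (plugK-headStep K h)

SN-ctxTree : ∀ {K c} → SNK K → SNᵀ c → SNᵀ (ctxTree K c)
SN-ctxTree □               sc = sc
SN-ctxTree (appK k ss)     sc = SN-node (SN-ctxTree k sc) (SN-leaf ss)
SN-ctxTree (projK k)       sc = SN-ctxTree k sc
SN-ctxTree (caseK k s₁ s₂) sc = SN-node (SN-ctxTree k sc) (SN-node (SN-leaf s₁) (SN-leaf s₂))
SN-ctxTree (hopK k s₁ s₂)  sc = SN-node (SN-ctxTree k sc) (SN-node (SN-leaf s₁) (SN-leaf s₂))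

⟶SN-headStep : ∀ {s t} → s ⟶SN t → ∃ λ c → SNᵀ c × HeadStep c s t
⟶SN-headStep (β {K} k st ss) = _ , SN-ctxTree k (SN-node (SN-leaf st) (SN-leaf ss)) , plugK-headStep K β
⟶SN-headStep (π {K} k s₁ s₂) = _ , SN-ctxTree k (SN-node (SN-leaf s₁) (SN-leaf s₂)) , plugK-headStep K π
⟶SN-headStep (ι {K} k st s₁ s₂) =
  _ , SN-ctxTree k (SN-node (SN-leaf st) (SN-node (SN-leaf s₁) (SN-leaf s₂))) , plugK-headStep K ι
⟶SN-headStep (hopIn {K} k st s₁ s₂) =
  _ , SN-ctxTree k (SN-node (SN-leaf st) (SN-node (SN-leaf s₁) (SN-leaf s₂))) , plugK-headStep K hopIn
⟶SN-headStep (hopEfq {K} {W} k w st s₁ s₂) =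
  _ , SN-ctxTree k (SN-node (SN-spineTree w st) (SN-node (SN-leaf s₁) (SN-leaf s₂)))
    , plugK-headStep K (hopEfq (plugW-spine W))

mainTheorem11 : ∀ (s t : Tm) → SN t → s ⟶SN t → SN s
mainTheorem11 s t snT s⟶t with ⟶SN-headStep s⟶t
... | c , snC , h = headStep-SN snC h snT
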